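{- Let $F=(V,E)$ be a forest of order $n$ and let $v\in V$. If $\left\lceil \frac{n+1}{\alpha_v+1}\right\rceil > 3$, then $v$ is the only vertex of $F$ of degree $\Delta(F)$. Consequently, if $\max\left\{3, \max_{x\in V} \left\lceil\frac{n+1}{\alpha_x+1}\right\rceil\right\} > 3$, then the maximum $\max_{x\in V} \left\lceil\frac{n+1}{\alpha_x+1}\right\rceil$ is attained by the unique vertex of degree $\Delta(F)$.
   Context: A stable set in a graph is a set of pairwise non-adjacent vertices. For a vertex $x$ of a graph $G$, an $x$-stable set is a stable set containing $x$, and $\alpha_x=\alpha_x(G)$ denotes the maximum size of an $x$-stable set in $G$. $\Delta(F)$ denotes the maximum degree of a vertex of $F$. -}

module Defs where

open import Data.Nat using (ℕ; zero; suc; _+_; _∸_; _⊔_; _/_; _≤_; _<_)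
open import Data.Bool using (Bool; true; false; if_then_else_)
open import Data.Fin using (Fin)
open import Data.Fin.Subset using (Subset; inside; outside; _∈_; ∣_∣)
open import Data.Vec using (tabulate)
open import Data.List using (List; []; _∷_; _∷ʳ_; map; foldr; allFin)
open import Data.List.Relation.Unary.Unique.Propositional using (Unique)
open import Data.List.Relation.Unary.Linked using (Linked)
open import Data.Product using (Σ; ∃; ∃-syntax; _×_)
open import Relation.Binary.PropositionalEquality using (_≡_)
open import Relation.Nullary using (¬_)

record Graph (n : ℕ) : Set where
  field
    adj   : Fin n → Fin n → Bool
    sym   : ∀ x y → adj x y ≡ adj y x
    irrefl : ∀ x → adj x x ≡ false

open Graph public

Adj : ∀ {n} → Graph n → Fin n → Fin n → Set
Adj G x y = adj G x y ≡ true

-- A cycle: distinct vertices x, y₁..yₖ (k ≥ 1), y with consecutive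
-- vertices adjacent and y adjacent to x (so length ≥ 3).
HasCycle : ∀ {n} → Graph n → Set
HasCycle {n} G =
  Σ (Fin n) λ x → Σ (Fin n) λ y → Σ (Fin n) λ z → Σ (List (Fin n)) λ ys →
    let p = (x ∷ z ∷ ys) ∷ʳ y in
    Unique p × Linked (Adj G) p × Adj G y x

Forest : ∀ {n} → Graph n → Set
Forest G = ¬ HasCycle G

Stable : ∀ {n} → Graph n → Subset n → Set
Stable G S = ∀ x y → x ∈ S → y ∈ S → ¬ Adj G x y

IsAlphaAt : ∀ {n} → Graph n → Fin n → ℕ → Set
IsAlphaAt G x a =
  (∃[ S ] (Stable G S × x ∈ S × ∣ S ∣ ≡ a)) ×
  (∀ S → Stable G S → x ∈ S → ∣ S ∣ ≤ a)

deg : ∀ {n} → Graph n → Fin n → ℕ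
deg G v = ∣ tabulate (λ w → if adj G v w then inside else outside) ∣

-- Maximum degree Δ(G) (0 for the empty graph).
Δ : ∀ {n} → Graph n → ℕ
Δ {n} G = foldr _⊔_ 0 (map (deg G) (allFin n))

⌈_/suc_⌉ : ℕ → ℕ → ℕ
⌈ a /suc b ⌉ = (a + b) / suc b

UniqueMaxDeg : ∀ {n} → Graph n → Fin n → Set
UniqueMaxDeg G v = deg G v ≡ Δ G × (∀ w → deg G w ≡ Δ G → w ≡ v)

-- Peeling off leaves shows that every set U of vertices of a forest contains a
-- stable set of size at least |U|/2. Applied to the non-neighbours of v this gives
-- a v-stable set witnessing n < deg v + 2 α_v. On the other hand a vertex w ≠ v has
-- at most one neighbour in the closed neighbourhood N[v] (two would close a cycle of
-- length 3 or 4), and its remaining neighbours together with v are stable, so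
-- deg w ≤ α_v. Finally ⌈(n+1)/(α_v+1)⌉ > 3 means n ≥ 3 α_v + 3, which with the
-- first bound forces α_v < deg v, hence deg w < deg v for every w ≠ v.
module Submission where

open import Defs hiding (sym)
open import Data.Nat using (ℕ; suc; _<_; _≤_)
open import Data.Fin using (Fin)
open import Data.Product using (_×_; ∃-syntax)

open import Data.Bool using (true; false; if_then_else_)
open import Data.Bool.Properties using () renaming (_≟_ to _≟ᵇ_)
open import Data.Empty using (⊥-elim)
open import Data.Fin.Properties using (_≟_; any?)
open import Data.Fin.Subset
  using (Subset; inside; outside; _∈_; _∉_; _⊆_; _⊂_; ⊥; ⊤; ⁅_⁆; ∁; _∩_; _∪_; _─_; _-_; ∣_∣; Nonempty; Empty)
open import Data.Fin.Subset.Properties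
  using ( _∈?_; nonempty?; Empty-unique; ∈⊤; ∉⊥; ⊥⊆; x∈⁅x⁆; x∈⁅y⁆⇒x≡y; x∈∁p⇒x∉p
        ; x∈p∩q⁻; x∈p∪q⁺; x∈p∪q⁻; q⊆p∪q; p─q⊆p; ⊆-⊂-trans; x∈p⇒p-x⊂p; x∈p∧x≢y⇒x∈p-y
        ; ∣p∣≤n; ∣⊥∣≡0; ∣⁅x⁆∣≡1; ∣∁p∣≡n∸∣p∣; ∣p∩q∣≤∣q∣; p⊆q⇒∣p∣≤∣q∣; p⊂q⇒∣p∣<∣q∣ )
open import Data.Fin.Subset.Induction using (Acc; acc; ⊂-wellFounded)
open import Data.List using (List; []; _∷_; _++_; _∷ʳ_; [_]; allFin)
open import Data.List.Properties using (++-assoc; foldr-preservesᵇ; foldr-preservesᵒ)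
open import Data.List.Extrema.Nat using (argmax; f[⊥]≤f[argmax]; f[xs]≤f[argmax])
open import Data.List.Membership.Propositional using () renaming (_∈_ to _∈ₗ_; _∉_ to _∉ₗ_)
open import Data.List.Membership.Propositional.Properties using (∈-∃++; ∈-allFin; ∈-map⁺)
import Data.List.Membership.DecPropositional as DecMembership
open import Data.List.Relation.Unary.All as All using (All; []; _∷_)
import Data.List.Relation.Unary.All.Properties as All
open import Data.List.Relation.Unary.Any as Any using (here; there)
open import Data.List.Relation.Unary.AllPairs using ([]; _∷_)
open import Data.List.Relation.Unary.Linked using (Linked; []; [-]; _∷_)
open import Data.List.Relation.Unary.Unique.Propositional using (Unique)
open import Data.Nat using (_+_; _*_; _⊔_; s≤s; z≤n)
open import Data.Nat.DivMod using (m/n*n≤m)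
open import Data.Nat.Properties
  using ( ≤-refl; ≤-reflexive; ≤-trans; ≤-antisym; <⇒≤; <-irrefl; ≤-<-trans; <-≤-trans
        ; n<1+n; m≤m+n; m+[n∸m]≡n; +-suc; *-suc; +-cancelˡ-≤; +-monoˡ-≤; +-monoʳ-≤
        ; +-monoʳ-<; *-monoˡ-≤; *-monoʳ-≤; m≤m⊔n; m≤n⊔m; ⊔-lub; module ≤-Reasoning )
open import Data.Nat.Tactic.RingSolver using (solve-∀)
open import Data.Product using (_,_; proj₂; ∃)
open import Data.Sum using (_⊎_; inj₁; inj₂; [_,_]′)
open import Data.Vec using (tabulate; []; _∷_; here; there)
open import Data.Vec.Properties using (lookup∘tabulate; lookup⇒[]=; []=⇒lookup)
open import Function using (id; _∘_)
open import Relation.Nullary using (¬_; yes; no)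
open import Relation.Nullary.Decidable using (_×-dec_; ¬?; decidable-stable)
open import Relation.Binary.PropositionalEquality
  using (_≡_; _≢_; refl; sym; trans; cong; subst)

∣p∣≡∣p∩q∣+∣p─q∣ : ∀ {n} (p q : Subset n) → ∣ p ∣ ≡ ∣ p ∩ q ∣ + ∣ p ─ q ∣
∣p∣≡∣p∩q∣+∣p─q∣ []            []            = refl
∣p∣≡∣p∩q∣+∣p─q∣ (inside  ∷ p) (inside  ∷ q) = cong suc (∣p∣≡∣p∩q∣+∣p─q∣ p q)
∣p∣≡∣p∩q∣+∣p─q∣ (inside  ∷ p) (outside ∷ q) =
  trans (cong suc (∣p∣≡∣p∩q∣+∣p─q∣ p q)) (sym (+-suc _ _))
∣p∣≡∣p∩q∣+∣p─q∣ (outside ∷ p) (inside  ∷ q) = ∣p∣≡∣p∩q∣+∣p─q∣ p q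
∣p∣≡∣p∩q∣+∣p─q∣ (outside ∷ p) (outside ∷ q) = ∣p∣≡∣p∩q∣+∣p─q∣ p q

∣p∣≤1+∣p-x∣ : ∀ {n} (p : Subset n) x → ∣ p ∣ ≤ suc ∣ p - x ∣
∣p∣≤1+∣p-x∣ p x = begin
  ∣ p ∣                     ≡⟨ ∣p∣≡∣p∩q∣+∣p─q∣ p ⁅ x ⁆ ⟩
  ∣ p ∩ ⁅ x ⁆ ∣ + ∣ p - x ∣ ≤⟨ +-monoˡ-≤ ∣ p - x ∣ (∣p∩q∣≤∣q∣ p ⁅ x ⁆) ⟩
  ∣ ⁅ x ⁆ ∣ + ∣ p - x ∣     ≡⟨ cong (_+ ∣ p - x ∣) (∣⁅x⁆∣≡1 x) ⟩
  suc ∣ p - x ∣             ∎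
  where open ≤-Reasoning

∣p∣+∣∁p∣≡n : ∀ {n} (p : Subset n) → ∣ p ∣ + ∣ ∁ p ∣ ≡ n
∣p∣+∣∁p∣≡n p = trans (cong (∣ p ∣ +_) (∣∁p∣≡n∸∣p∣ p)) (m+[n∸m]≡n (∣p∣≤n p))

∣p∣≤1 : ∀ {n} {p : Subset n} → (∀ {x y} → x ∈ p → y ∈ p → x ≡ y) → ∣ p ∣ ≤ 1
∣p∣≤1 {n} {p} subsingleton with nonempty? p
... | yes (x , x∈p) = ≤-trans (p⊆q⇒∣p∣≤∣q∣ p⊆⁅x⁆) (≤-reflexive (∣⁅x⁆∣≡1 x))
  where
  p⊆⁅x⁆ : p ⊆ ⁅ x ⁆
  p⊆⁅x⁆ y∈p = subst (_∈ ⁅ x ⁆) (subsingleton x∈p y∈p) (x∈⁅x⁆ x)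
... | no empty = ≤-trans (≤-reflexive (trans (cong ∣_∣ (Empty-unique empty)) (∣⊥∣≡0 n))) z≤n

x∈⁅x⁆∪p : ∀ {n} (x : Fin n) {p} → x ∈ ⁅ x ⁆ ∪ p
x∈⁅x⁆∪p x = x∈p∪q⁺ (inj₁ (x∈⁅x⁆ x))

x∉p⇒∣p∣<∣⁅x⁆∪p∣ : ∀ {n} {x : Fin n} {p} → x ∉ p → ∣ p ∣ < ∣ ⁅ x ⁆ ∪ p ∣
x∉p⇒∣p∣<∣⁅x⁆∪p∣ {x = x} {p} x∉p =
  p⊂q⇒∣p∣<∣q∣ (q⊆p∪q ⁅ x ⁆ p , x , x∈⁅x⁆∪p x , x∉p)

x∈⁅y⁆∪p⁻ : ∀ {n} {x y : Fin n} {p} → x ∈ ⁅ y ⁆ ∪ p → x ≡ y ⊎ x ∈ p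
x∈⁅y⁆∪p⁻ {y = y} {p} x∈ = [ inj₁ ∘ x∈⁅y⁆⇒x≡y y , inj₂ ]′ (x∈p∪q⁻ ⁅ y ⁆ p x∈)

x∈p─q⇒x∉q : ∀ {n} (p q : Subset n) {x} → x ∈ p ─ q → x ∉ q
x∈p─q⇒x∉q (_ ∷ p) (outside ∷ q) here          ()
x∈p─q⇒x∉q (_ ∷ p) (_       ∷ q) (there x∈p─q) (there x∈q) = x∈p─q⇒x∉q p q x∈p─q x∈q

x∈p-y⇒x≢y : ∀ {n} {p : Subset n} {x y} → x ∈ p - y → x ≢ y
x∈p-y⇒x≢y {p = p} {y = y} x∈p-y refl = x∈p─q⇒x∉q p ⁅ y ⁆ x∈p-y (x∈⁅x⁆ y)

Unique-++⁻ˡ : ∀ {A : Set} (xs : List A) {ys} → Unique (xs ++ ys) → Unique xs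
Unique-++⁻ˡ []       _            = []
Unique-++⁻ˡ (x ∷ xs) (x∉ ∷ uniq) = All.++⁻ˡ xs x∉ ∷ Unique-++⁻ˡ xs uniq

Linked-++⁻ˡ : ∀ {A : Set} {R : A → A → Set} (xs : List A) {ys} →
              Linked R (xs ++ ys) → Linked R xs
Linked-++⁻ˡ []           _         = []
Linked-++⁻ˡ (x ∷ [])     _         = [-]
Linked-++⁻ˡ (x ∷ y ∷ xs) (r ∷ rs) = r ∷ Linked-++⁻ˡ (y ∷ xs) rs

m<⌈n/1+o⌉⇒[1+m]*[1+o]≤n+o : ∀ {m n o} → m < ⌈ n /suc o ⌉ → suc m * suc o ≤ n + o
m<⌈n/1+o⌉⇒[1+m]*[1+o]≤n+o {n = n} {o} m<⌈n/o⌉ =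
  ≤-trans (*-monoˡ-≤ (suc o) m<⌈n/o⌉) (m/n*n≤m (n + o) (suc o))

4[1+a]≤m+a⇒m≤d+2a⇒a<d : ∀ {a d m} → 4 * suc a ≤ m + a → m ≤ d + 2 * a → a < d
4[1+a]≤m+a⇒m≤d+2a⇒a<d {a} {d} {m} 4[a+1]≤m+a m≤d+2a = +-cancelˡ-≤ (3 * a) _ _ (begin
  3 * a + suc a       ≤⟨ m≤m+n (3 * a + suc a) 3 ⟩
  3 * a + suc a + 3   ≡⟨ four-copies a ⟩
  4 * suc a           ≤⟨ 4[a+1]≤m+a ⟩
  m + a               ≤⟨ +-monoˡ-≤ a m≤d+2a ⟩
  d + 2 * a + a       ≡⟨ three-copies a d ⟩
  3 * a + d           ∎)
  where
  open ≤-Reasoning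

  four-copies : ∀ a → 3 * a + suc a + 3 ≡ 4 * suc a
  four-copies = solve-∀

  three-copies : ∀ a d → d + 2 * a + a ≡ 3 * a + d
  three-copies = solve-∀

module _ {n : ℕ} (G : Graph n) where

  N : Fin n → Subset n
  N v = tabulate (λ w → if adj G v w then inside else outside)

  N[_] : Fin n → Subset n
  N[ v ] = ⁅ v ⁆ ∪ N v

  -- Vertices isolated in G[U] count as leaves too.
  LeafIn : Subset n → Fin n → Set
  LeafIn U u = u ∈ U × ∃[ a ] (∀ {w} → w ∈ U → Adj G u w → w ≡ a)

  Adj-sym : ∀ {x y} → Adj G x y → Adj G y x
  Adj-sym {x} {y} xy = trans (Graph.sym G y x) xy

  Adj⇒≢ : ∀ {x y} → Adj G x y → x ≢ y
  Adj⇒≢ {x} xx refl with trans (sym xx) (irrefl G x)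
  ... | ()

  Adj⇒∈N : ∀ {v w} → Adj G v w → w ∈ N v
  Adj⇒∈N {v} {w} vw = lookup⇒[]= w (N v)
    (trans (lookup∘tabulate _ w) (cong (λ b → if b then inside else outside) vw))

  ∈N⇒Adj : ∀ {v w} → w ∈ N v → Adj G v w
  ∈N⇒Adj {v} {w} w∈N
    with adj G v w | trans (sym (lookup∘tabulate _ w)) ([]=⇒lookup w∈N)
  ... | true  | _  = refl
  ... | false | ()

  ∈N[]⁻ : ∀ {v w} → w ∈ N[ v ] → w ≡ v ⊎ Adj G v w
  ∈N[]⁻ w∈ = [ inj₁ , inj₂ ∘ ∈N⇒Adj ]′ (x∈⁅y⁆∪p⁻ w∈)

  triangle : ∀ {a b c} → Adj G a b → Adj G b c → Adj G c a → HasCycle G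
  triangle {a} {b} {c} ab bc ca =
    a , c , b , [] ,
    ((Adj⇒≢ ab ∷ Adj⇒≢ (Adj-sym ca) ∷ []) ∷ (Adj⇒≢ bc ∷ []) ∷ [] ∷ []) ,
    (ab ∷ bc ∷ [-]) , ca

  square : ∀ {a b c d} → a ≢ c → b ≢ d →
           Adj G a b → Adj G b c → Adj G c d → Adj G d a → HasCycle G
  square {a} {b} {c} {d} a≢c b≢d ab bc cd da =
    a , d , b , c ∷ [] ,
    ((Adj⇒≢ ab ∷ a≢c ∷ Adj⇒≢ (Adj-sym da) ∷ []) ∷ (Adj⇒≢ bc ∷ b≢d ∷ []) ∷
      (Adj⇒≢ cd ∷ []) ∷ [] ∷ []) ,
    (ab ∷ bc ∷ cd ∷ [-]) , da

  Stable-⁅x⁆∪ : ∀ {S x} → Stable G S → (∀ {w} → w ∈ S → ¬ Adj G x w) →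
                Stable G (⁅ x ⁆ ∪ S)
  Stable-⁅x⁆∪ stable x-free y z y∈ z∈ yz with x∈⁅y⁆∪p⁻ y∈ | x∈⁅y⁆∪p⁻ z∈
  ... | inj₁ refl | inj₁ refl = Adj⇒≢ yz refl
  ... | inj₁ refl | inj₂ z∈S  = x-free z∈S yz
  ... | inj₂ y∈S  | inj₁ refl = x-free y∈S (Adj-sym yz)
  ... | inj₂ y∈S  | inj₂ z∈S  = stable y z y∈S z∈S yz

  chord⇒HasCycle : ∀ {x z zs y} → Unique (x ∷ z ∷ zs) → Linked (Adj G) (x ∷ z ∷ zs) →
                   y ∈ₗ zs → Adj G y x → HasCycle G
  chord⇒HasCycle {x} {z} {y = y} uniq path y∈zs yx with ∈-∃++ y∈zs
  ... | ys , post , refl =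
    x , y , z , ys ,
    Unique-++⁻ˡ (x ∷ z ∷ ys ∷ʳ y) (subst Unique cycle++post uniq) ,
    Linked-++⁻ˡ (x ∷ z ∷ ys ∷ʳ y) (subst (Linked (Adj G)) cycle++post path) , yx
    where
    cycle++post : x ∷ z ∷ ys ++ y ∷ post ≡ (x ∷ z ∷ ys ∷ʳ y) ++ post
    cycle++post = cong (λ t → x ∷ z ∷ t) (sym (++-assoc ys [ y ] post))

  private
    open DecMembership (_≟_ {n}) using () renaming (_∈?_ to _∈ₗ?_)

    previous : Fin n → List (Fin n) → Fin n
    previous x []      = x
    previous x (z ∷ _) = z

    revisit⇒HasCycle : ∀ {x rest y} → Unique (x ∷ rest) → Linked (Adj G) (x ∷ rest) →
                       Adj G x y → y ≢ previous x rest → y ∈ₗ x ∷ rest → HasCycle G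
    revisit⇒HasCycle _ _ xy _ (here refl) = ⊥-elim (Adj⇒≢ xy refl)
    revisit⇒HasCycle {rest = z ∷ zs} _ _ _ y≢z (there (here refl)) = ⊥-elim (y≢z refl)
    revisit⇒HasCycle {rest = z ∷ zs} uniq path xy _ (there (there y∈zs)) =
      chord⇒HasCycle uniq path y∈zs (Adj-sym xy)

    -- Walk inside U, never stepping back, until stuck (a leaf) or revisiting
    -- (a cycle); R contains every vertex not on the path and bounds the walk.
    leaf-or-cycle : ∀ U R → Acc _⊂_ R → ∀ x rest → x ∈ U →
                    (∀ {w} → w ∉ₗ x ∷ rest → w ∈ R) →
                    Unique (x ∷ rest) → Linked (Adj G) (x ∷ rest) →
                    ∃ (LeafIn U) ⊎ HasCycle G
    leaf-or-cycle U R (acc smaller) x rest x∈U unvisited uniq path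
      with any? (λ w → w ∈? U ×-dec adj G x w ≟ᵇ true ×-dec ¬? (w ≟ previous x rest))
    ... | no stuck = inj₁ (x , x∈U , previous x rest , λ {w} w∈U xw →
          decidable-stable (w ≟ previous x rest) (λ w≢prev → stuck (w , w∈U , xw , w≢prev)))
    ... | yes (y , y∈U , xy , y≢prev) with y ∈ₗ? x ∷ rest
    ...   | yes y∈path = inj₂ (revisit⇒HasCycle uniq path xy y≢prev y∈path)
    ...   | no  y∉path =
      leaf-or-cycle U (R - y) (smaller (x∈p⇒p-x⊂p (unvisited y∉path))) y (x ∷ rest) y∈U
        unvisited′ (All.¬Any⇒All¬ _ y∉path ∷ uniq) (Adj-sym xy ∷ path)
      where
      unvisited′ : ∀ {w} → w ∉ₗ y ∷ x ∷ rest → w ∈ R - y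
      unvisited′ w∉ = x∈p∧x≢y⇒x∈p-y (unvisited (w∉ ∘ there)) (w∉ ∘ here)

  StableHalf : Subset n → Subset n → Set
  StableHalf U S = S ⊆ U × Stable G S × ∣ U ∣ ≤ 2 * ∣ S ∣

  StableHalf-⊥ : ∀ {U} → Empty U → StableHalf U ⊥
  StableHalf-⊥ empty =
    ⊥⊆ , (λ _ _ x∈⊥ → ⊥-elim (∉⊥ x∈⊥)) ,
    ≤-trans (≤-reflexive (trans (cong ∣_∣ (Empty-unique empty)) (∣⊥∣≡0 n))) z≤n

  StableHalf-⁅x⁆∪ : ∀ {U S u a} → u ∈ U → (∀ {w} → w ∈ U → Adj G u w → w ≡ a) →
                    StableHalf (U - u - a) S → StableHalf U (⁅ u ⁆ ∪ S)
  StableHalf-⁅x⁆∪ {U} {S} {u} {a} u∈U only-a (S⊆U′ , stable , |U′|≤2|S|) =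
    S⁺⊆U , Stable-⁅x⁆∪ stable u-free , size
    where
    ∈U′⇒∈U : ∀ {w} → w ∈ U - u - a → w ∈ U
    ∈U′⇒∈U = p─q⊆p U ⁅ u ⁆ ∘ p─q⊆p (U - u) ⁅ a ⁆

    S⁺⊆U : ⁅ u ⁆ ∪ S ⊆ U
    S⁺⊆U w∈ with x∈⁅y⁆∪p⁻ w∈
    ... | inj₁ refl = u∈U
    ... | inj₂ w∈S  = ∈U′⇒∈U (S⊆U′ w∈S)

    u-free : ∀ {w} → w ∈ S → ¬ Adj G u w
    u-free w∈S uw = x∈p-y⇒x≢y (S⊆U′ w∈S) (only-a (∈U′⇒∈U (S⊆U′ w∈S)) uw)

    u∉S : u ∉ S
    u∉S u∈S = x∈p-y⇒x≢y (p─q⊆p (U - u) ⁅ a ⁆ (S⊆U′ u∈S)) refl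

    size : ∣ U ∣ ≤ 2 * ∣ ⁅ u ⁆ ∪ S ∣
    size = begin
      ∣ U ∣                 ≤⟨ ∣p∣≤1+∣p-x∣ U u ⟩
      suc ∣ U - u ∣         ≤⟨ s≤s (∣p∣≤1+∣p-x∣ (U - u) a) ⟩
      2 + ∣ U - u - a ∣     ≤⟨ +-monoʳ-≤ 2 |U′|≤2|S| ⟩
      2 + 2 * ∣ S ∣         ≡⟨ *-suc 2 ∣ S ∣ ⟨
      2 * suc ∣ S ∣         ≤⟨ *-monoʳ-≤ 2 (x∉p⇒∣p∣<∣⁅x⁆∪p∣ u∉S) ⟩
      2 * ∣ ⁅ u ⁆ ∪ S ∣     ∎
      where open ≤-Reasoning

  module _ (acyclic : Forest G) where

    forest-leaf : ∀ {U} → Nonempty U → ∃ (LeafIn U)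
    forest-leaf {U} (x , x∈U) =
      [ id , ⊥-elim ∘ acyclic ]′
        (leaf-or-cycle U ⊤ (⊂-wellFounded ⊤) x [] x∈U (λ _ → ∈⊤) ([] ∷ []) [-])

    forest-stable-half : ∀ U → ∃ (StableHalf U)
    forest-stable-half U = go U (⊂-wellFounded U)
      where
      go : ∀ U → Acc _⊂_ U → ∃ (StableHalf U)
      go U (acc smaller) with nonempty? U
      ... | no empty = ⊥ , StableHalf-⊥ empty
      ... | yes nonempty with forest-leaf nonempty
      ... | u , u∈U , a , only-a =
        let S , half = go (U - u - a) (smaller (⊆-⊂-trans (p─q⊆p (U - u) ⁅ a ⁆) (x∈p⇒p-x⊂p u∈U)))
        in  ⁅ u ⁆ ∪ S , StableHalf-⁅x⁆∪ u∈U only-a half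

    ∣N∩N[]∣≤1 : ∀ {v w} → w ≢ v → ∣ N w ∩ N[ v ] ∣ ≤ 1
    ∣N∩N[]∣≤1 {v} {w} w≢v = ∣p∣≤1 λ x∈ y∈ → same (x∈p∩q⁻ _ _ x∈) (x∈p∩q⁻ _ _ y∈)
      where
      same : ∀ {x y} → x ∈ N w × x ∈ N[ v ] → y ∈ N w × y ∈ N[ v ] → x ≡ y
      same {x} {y} (x∈Nw , x∈N[v]) (y∈Nw , y∈N[v]) with ∈N[]⁻ x∈N[v] | ∈N[]⁻ y∈N[v]
      ... | inj₁ refl | inj₁ refl = refl
      ... | inj₁ refl | inj₂ vy   =
        ⊥-elim (acyclic (triangle (∈N⇒Adj x∈Nw) vy (Adj-sym (∈N⇒Adj y∈Nw))))
      ... | inj₂ vx   | inj₁ refl =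
        ⊥-elim (acyclic (triangle (∈N⇒Adj y∈Nw) vx (Adj-sym (∈N⇒Adj x∈Nw))))
      ... | inj₂ vx   | inj₂ vy   = decidable-stable (x ≟ y) λ x≢y →
        acyclic (square w≢v x≢y (∈N⇒Adj x∈Nw) (Adj-sym vx) vy (Adj-sym (∈N⇒Adj y∈Nw)))

    module _ (α : Fin n → ℕ) (α-max : ∀ {v S} → Stable G S → v ∈ S → ∣ S ∣ ≤ α v) where

      n<deg+2α : ∀ v → n < deg G v + 2 * α v
      n<deg+2α v with forest-stable-half (∁ (N v) - v)
      ... | S , S⊆ , stable , |U|≤2|S| = begin-strict
        n                                  ≡⟨ ∣p∣+∣∁p∣≡n (N v) ⟨
        deg G v + ∣ ∁ (N v) ∣              ≤⟨ +-monoʳ-≤ (deg G v) (∣p∣≤1+∣p-x∣ (∁ (N v)) v) ⟩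
        deg G v + suc ∣ ∁ (N v) - v ∣      ≤⟨ +-monoʳ-≤ (deg G v) (s≤s |U|≤2|S|) ⟩
        deg G v + suc (2 * ∣ S ∣)          <⟨ +-monoʳ-< (deg G v) (n<1+n _) ⟩
        deg G v + (2 + 2 * ∣ S ∣)          ≡⟨ cong (deg G v +_) (*-suc 2 ∣ S ∣) ⟨
        deg G v + 2 * suc ∣ S ∣            ≤⟨ +-monoʳ-≤ (deg G v) (*-monoʳ-≤ 2 v-stable) ⟩
        deg G v + 2 * α v                  ∎
        where
        open ≤-Reasoning

        v-free : ∀ {w} → w ∈ S → ¬ Adj G v w
        v-free w∈S vw = x∈∁p⇒x∉p (p─q⊆p (∁ (N v)) ⁅ v ⁆ (S⊆ w∈S)) (Adj⇒∈N vw)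

        v-stable : suc ∣ S ∣ ≤ α v
        v-stable = ≤-trans (x∉p⇒∣p∣<∣⁅x⁆∪p∣ (λ v∈S → x∈p-y⇒x≢y (S⊆ v∈S) refl))
                           (α-max (Stable-⁅x⁆∪ stable v-free) (x∈⁅x⁆∪p v))

      deg≤α : ∀ {v w} → w ≢ v → deg G w ≤ α v
      deg≤α {v} {w} w≢v = begin
        deg G w                          ≡⟨ ∣p∣≡∣p∩q∣+∣p─q∣ (N w) N[ v ] ⟩
        ∣ N w ∩ N[ v ] ∣ + ∣ X ∣         ≤⟨ +-monoˡ-≤ ∣ X ∣ (∣N∩N[]∣≤1 w≢v) ⟩
        suc ∣ X ∣                        ≤⟨ x∉p⇒∣p∣<∣⁅x⁆∪p∣ v∉X ⟩
        ∣ ⁅ v ⁆ ∪ X ∣                    ≤⟨ α-max (Stable-⁅x⁆∪ X-stable v-free) (x∈⁅x⁆∪p v) ⟩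
        α v                              ∎
        where
        open ≤-Reasoning

        X : Subset n
        X = N w ─ N[ v ]

        v∉X : v ∉ X
        v∉X v∈X = x∈p─q⇒x∉q (N w) N[ v ] v∈X (x∈⁅x⁆∪p v)

        X⊆N : ∀ {x} → x ∈ X → Adj G w x
        X⊆N = ∈N⇒Adj ∘ p─q⊆p (N w) N[ v ]

        X-stable : Stable G X
        X-stable x y x∈X y∈X xy = acyclic (triangle (X⊆N x∈X) xy (Adj-sym (X⊆N y∈X)))

        v-free : ∀ {y} → y ∈ X → ¬ Adj G v y
        v-free y∈X vy = x∈p─q⇒x∉q (N w) N[ v ] y∈X (x∈p∪q⁺ (inj₂ (Adj⇒∈N vy)))

      α<deg : ∀ v → 3 < ⌈ suc n /suc α v ⌉ → α v < deg G v
      α<deg v 3<⌈⌉ = 4[1+a]≤m+a⇒m≤d+2a⇒a<d (m<⌈n/1+o⌉⇒[1+m]*[1+o]≤n+o 3<⌈⌉) (n<deg+2α v)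

  deg≤Δ : ∀ v → deg G v ≤ Δ G
  deg≤Δ v = foldr-preservesᵒ ⊔-upper 0 _ (inj₂ (Any.map ≤-reflexive (∈-map⁺ (deg G) (∈-allFin v))))
    where
    ⊔-upper : ∀ x y → deg G v ≤ x ⊎ deg G v ≤ y → deg G v ≤ x ⊔ y
    ⊔-upper x y = [ (λ p → ≤-trans p (m≤m⊔n x y)) , (λ p → ≤-trans p (m≤n⊔m x y)) ]′

  Δ≤ : ∀ {m} → (∀ w → deg G w ≤ m) → Δ G ≤ m
  Δ≤ {m} bound = foldr-preservesᵇ {P = _≤ m} ⊔-lub z≤n (All.map⁺ (All.tabulate⁺ bound))

  strict-max⇒UniqueMaxDeg : ∀ {v} → (∀ {w} → w ≢ v → deg G w < deg G v) → UniqueMaxDeg G v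
  strict-max⇒UniqueMaxDeg {v} below = deg≡Δ , only-v
    where
    ≤deg : ∀ w → deg G w ≤ deg G v
    ≤deg w with w ≟ v
    ... | yes refl = ≤-refl
    ... | no  w≢v  = <⇒≤ (below w≢v)

    deg≡Δ : deg G v ≡ Δ G
    deg≡Δ = ≤-antisym (deg≤Δ v) (Δ≤ ≤deg)

    only-v : ∀ w → deg G w ≡ Δ G → w ≡ v
    only-v w deg≡ = decidable-stable (w ≟ v) λ w≢v →
      <-irrefl (trans deg≡ (sym deg≡Δ)) (below w≢v)

lemma5 : ∀ (n : ℕ) (F : Graph n) → Forest F →
    (α : Fin n → ℕ) → (∀ x → IsAlphaAt F x (α x)) →
    (∀ v → 3 < ⌈ suc n /suc α v ⌉ → UniqueMaxDeg F v) ×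
    ((∃[ x ] 3 < ⌈ suc n /suc α x ⌉) →
      ∃[ u ] (UniqueMaxDeg F u ×
              (∀ x → ⌈ suc n /suc α x ⌉ ≤ ⌈ suc n /suc α u ⌉)))
lemma5 n F acyclic α isα = unique , attained
  where
  α-max : ∀ {v S} → Stable F S → v ∈ S → ∣ S ∣ ≤ α v
  α-max {v} {S} = proj₂ (isα v) S

  unique : ∀ v → 3 < ⌈ suc n /suc α v ⌉ → UniqueMaxDeg F v
  unique v 3<⌈⌉ = strict-max⇒UniqueMaxDeg F λ w≢v →
    ≤-<-trans (deg≤α F acyclic α α-max w≢v) (α<deg F acyclic α α-max v 3<⌈⌉)

  ratio : Fin n → ℕ
  ratio x = ⌈ suc n /suc α x ⌉

  attained : (∃[ x ] 3 < ratio x) → ∃[ u ] (UniqueMaxDeg F u × (∀ x → ratio x ≤ ratio u))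
  attained (x , 3<ratio) =
    u , unique u (<-≤-trans 3<ratio (f[⊥]≤f[argmax] {f = ratio} x (allFin n))) , max
    where
    u : Fin n
    u = argmax ratio x (allFin n)

    max : ∀ y → ratio y ≤ ratio u
    max y = All.lookup (f[xs]≤f[argmax] {f = ratio} x (allFin n)) (∈-allFin y)
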